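{- Let $M\subseteq\{0,1\}^n$ be a matching realizable even $\Delta$-matroid and let $f,g\in M$. Then the set $f\triangle g$ of coordinates on which $f$ and $g$ differ can be partitioned into pairs $P_1,\dots,P_k$ such that $f\oplus P_i\in M$ and $g\oplus P_i\in M$ for every $i=1,\dots,k$.
   Context: For a tuple $\alpha$ and a set $S$ of coordinates, $\alpha\oplus S$ is obtained from $\alpha$ by flipping the values at all coordinates in $S$. A nonempty $M\subseteq\{0,1\}^n$ is a $\Delta$-matroid if for all $\alpha,\beta\in M$ and coordinates $v$ with $\alpha(v)\neq\beta(v)$ there is $u$ with $\alpha(u)\ne\beta(u)$ and $\alpha\oplus\{u,v\}\in M$; it is even if all tuples of $M$ have the same parity of number of ones. Let $G$ be a finite graph and $v_1,\dots,v_a$ distinct vertices. For $T=(x_1,\dots,x_a)\in\{0,1\}^a$, $G_T$ is obtained from $G$ by deleting all $v_i$ with $x_i=1$; $M(G,v_1,\dots,v_a)=\{T\in\{0,1\}^a: G_T$ has a perfect matching$\}$. A relation $R\subseteq\{0,1\}^a$ is matching realizable if $R=M(G,v_1,\dots,v_a)$ for some graph $G$ and distinct vertices $v_1,\dots,v_a$. -}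

module Defs where

open import Data.Nat using (ℕ; zero; suc; _+_; _%_)
open import Data.Bool using (Bool; true; false; not; if_then_else_; _∨_)
open import Data.Fin using (Fin; zero; suc; _≟_)
open import Data.Product using (Σ; ∃; ∃-syntax; _×_; _,_)
open import Relation.Nullary using (¬_; does)
open import Relation.Binary.PropositionalEquality using (_≡_; _≢_)
open import Function using (_∘_; _⇔_)
open import Function.Definitions using (Injective)

-- A tuple in {0,1}^n (true = 1) and a relation R ⊆ {0,1}^n (as a predicate).
Tuple : ℕ → Set
Tuple n = Fin n → Bool

Rel01 : ℕ → Set₁
Rel01 n = Tuple n → Set

-- α ⊕ {u , v} : flip the values at coordinates u and v (a single flip when u ≡ v).
flip2 : ∀ {n} → Tuple n → Fin n → Fin n → Tuple n
flip2 α u v i = if does (i ≟ u) ∨ does (i ≟ v) then not (α i) else α i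

ones : ∀ {n} → Tuple n → ℕ
ones {zero}  α = 0
ones {suc n} α = (if α zero then 1 else 0) + ones (α ∘ suc)

IsDeltaMatroid : ∀ {n} → Rel01 n → Set
IsDeltaMatroid {n} M =
  (∃[ α ] M α) ×
  (∀ α β → M α → M β → ∀ (v : Fin n) → α v ≢ β v →
     ∃[ u ] (α u ≢ β u × M (flip2 α u v)))

IsEven : ∀ {n} → Rel01 n → Set
IsEven M = ∀ α β → M α → M β → ones α % 2 ≡ ones β % 2

record Graph : Set₁ where
  field
    m      : ℕ
    Adj    : Fin m → Fin m → Set
    sym    : ∀ {x y} → Adj x y → Adj y x
    irrefl : ∀ {x} → ¬ Adj x x

-- G_T: vertex x is deleted iff x = v i for some i with T i = 1.
Deleted : (G : Graph) → ∀ {a} → (Fin a → Fin (Graph.m G)) → Tuple a →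
          Fin (Graph.m G) → Set
Deleted G {a} vs T x = ∃[ i ] (vs i ≡ x × T i ≡ true)

-- A perfect matching of the induced subgraph on the non-deleted vertices,
-- given as its partner map μ (a fixed-point-free involution on the remaining
-- vertices along edges).
HasPerfectMatching : (G : Graph) → ∀ {a} → (Fin a → Fin (Graph.m G)) → Tuple a → Set
HasPerfectMatching G vs T =
  Σ (Fin (Graph.m G) → Fin (Graph.m G)) λ μ →
    ∀ x → ¬ Deleted G vs T x →
      (¬ Deleted G vs T (μ x)) × Graph.Adj G x (μ x) × μ (μ x) ≡ x × μ x ≢ x

MatchRel : (G : Graph) → ∀ {a} → (Fin a → Fin (Graph.m G)) → Rel01 a
MatchRel G vs T = HasPerfectMatching G vs T

MatchingRealizable : ∀ {a} → Rel01 a → Set₁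
MatchingRealizable {a} R =
  Σ Graph λ G → Σ (Fin a → Fin (Graph.m G)) λ vs →
    Injective _≡_ _≡_ vs × (∀ T → R T ⇔ MatchRel G vs T)

-- A partition of the coordinate set f △ g into pairs {x , π x}, encoded as a
-- fixed-point-free involution π on f △ g; each block P satisfies f ⊕ P ∈ M, g ⊕ P ∈ M.
PairPartition : ∀ {n} → Rel01 n → Tuple n → Tuple n → Set
PairPartition {n} M f g =
  Σ (Fin n → Fin n) λ π →
    ∀ x → f x ≢ g x →
      f (π x) ≢ g (π x) × π x ≢ x × π (π x) ≡ x ×
      M (flip2 f x (π x)) × M (flip2 g x (π x))

-- Realize M as M(G, v₁, …, vₙ) and take perfect matchings μ_f of G_f and μ_g of G_g.
-- A coordinate c with f c ≠ g c makes v_c present in exactly one of G_f, G_g, so it is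
-- the end of a path in μ_f ∪ μ_g alternating between the two matchings.  Such a path is
-- finite and ends at another vertex v_j present in exactly one of the two graphs, and
-- walking it backwards from v_j leads to v_c; so c ↦ j is a fixed-point-free involution
-- of f △ g.  Swapping μ_f and μ_g along the path from v_c to v_j gives perfect matchings
-- of G_{f ⊕ {c,j}} and of G_{g ⊕ {c,j}}.
module Submission where

open import Defs
open import Data.Nat using (ℕ; zero; suc; _+_; _*_; _∸_; _≤_; _<_; s≤s; s≤s⁻¹; z<s)
open import Data.Nat.Properties
  using (anyUpTo?; <-cmp; m≤n⇒m<n∨m≡n; n<1+n; <⇒≤; <-trans; ≤-refl; ≤-trans;
         ≤-reflexive; +-suc; +-identityʳ; m≤n+m; m+[n∸m]≡n; m∸n≤m; suc-injective)
open import Data.Bool as Bool using (Bool; true; false; not; if_then_else_)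
open import Data.Bool.Properties using (not-involutive; not-injective; not-¬; ¬-not; ∨-zeroʳ)
open import Data.Fin using (Fin; toℕ; combine; _≟_)
open import Data.Fin.Properties using (any?; pigeonhole; combine-injective; toℕ≤pred[n]; 2↔Bool)
open import Data.Product using (∃; _×_; _,_; proj₁; proj₂)
open import Data.Sum using (_⊎_; inj₁; inj₂)
open import Data.Empty using (⊥-elim)
open import Relation.Nullary using (¬_; Dec; yes; no; does)
open import Relation.Nullary.Decidable using (_×-dec_; ¬?; dec-true; dec-false; decidable-stable)
open import Relation.Unary using (Decidable)
open import Relation.Binary using (tri<; tri≈; tri>)
open import Relation.Binary.PropositionalEquality
  using (_≡_; _≢_; refl; sym; trans; cong; cong₂; subst; subst₂; module ≡-Reasoning)
open import Function using (_∘_; _⇔_; mk⇔; Equivalence; _↣_; Injection)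
open import Function.Definitions using (Injective)
open import Function.Properties.Inverse using (↔⇒↣; ↔-sym)

open Equivalence using (to; from)

Bool-cover : ∀ {p} {P : Bool → Set p} b → P b → P (not b) → ∀ t → P t
Bool-cover false p _ false = p
Bool-cover false _ q true  = q
Bool-cover true  p _ true  = p
Bool-cover true  _ q false = q

FirstFailure : (ℕ → Set) → ℕ → Set
FirstFailure P k = (∀ l → l ≤ k → P l) × ¬ P (suc k)

firstFailure-unique : ∀ {P k k′} → FirstFailure P k → FirstFailure P k′ → k ≡ k′
firstFailure-unique {k = k} {k′} (holds , fails) (holds′ , fails′) with <-cmp k k′
... | tri< k<k′ _ _ = ⊥-elim (fails (holds′ (suc k) k<k′))
... | tri≈ _ k≡k′ _ = k≡k′
... | tri> _ _ k′<k = ⊥-elim (fails′ (holds (suc k′) k′<k))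

firstFailure-or-all : ∀ {P} → Decidable P → P 0 → ∀ N → ∃ (FirstFailure P) ⊎ (∀ l → l ≤ N → P l)
firstFailure-or-all P? p₀ zero = inj₂ λ { zero _ → p₀ }
firstFailure-or-all {P} P? p₀ (suc N) with firstFailure-or-all P? p₀ N
... | inj₁ failure = inj₁ failure
... | inj₂ holds with P? (suc N)
...   | no fails = inj₁ (N , holds , fails)
...   | yes p = inj₂ λ l l≤1+N → extend l (m≤n⇒m<n∨m≡n l≤1+N)
  where
  extend : ∀ l → l < suc N ⊎ l ≡ suc N → P l
  extend l (inj₁ l<1+N) = holds l (s≤s⁻¹ l<1+N)
  extend l (inj₂ refl)  = p

preimage : ∀ {m n} → (Fin n → Fin m) → Fin n → Fin m → Fin n
preimage h default y with any? (λ c → h c ≟ y)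
... | yes (c , _) = c
... | no _        = default

preimage-image : ∀ {m n} {h : Fin n → Fin m} → Injective _≡_ _≡_ h →
                 ∀ default c → preimage h default (h c) ≡ c
preimage-image {h = h} h-injective default c with any? (λ c′ → h c′ ≟ h c)
... | yes (_ , hc′≡hc) = h-injective hc′≡hc
... | no none          = ⊥-elim (none (c , refl))

flip2-first : ∀ {n} (α : Tuple n) u v → flip2 α u v u ≡ not (α u)
flip2-first α u v rewrite dec-true (u ≟ u) refl = refl

flip2-second : ∀ {n} (α : Tuple n) u v → flip2 α u v v ≡ not (α v)
flip2-second α u v rewrite dec-true (v ≟ v) refl | ∨-zeroʳ (does (v ≟ u)) = refl

flip2-other : ∀ {n} (α : Tuple n) {u v i} → i ≢ u → i ≢ v → flip2 α u v i ≡ α i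
flip2-other α {u} {v} {i} i≢u i≢v rewrite dec-false (i ≟ u) i≢u | dec-false (i ≟ v) i≢v = refl

PairPartition-mono : ∀ {n} {M M′ : Rel01 n} {f g} → (∀ T → M′ T → M T) →
                     PairPartition M′ f g → PairPartition M f g
PairPartition-mono M′⊆M (π , paired) = π , λ c c-differs →
  let (differs , π≢ , π-involutive , f-flip , g-flip) = paired c c-differs
  in differs , π≢ , π-involutive , M′⊆M _ f-flip , M′⊆M _ g-flip

IsPerfectMatching : {V : Set} → (V → V → Set) → (V → Set) → (V → V) → Set
IsPerfectMatching Adj P μ = ∀ x → P x → P (μ x) × Adj x (μ x) × μ (μ x) ≡ x × μ x ≢ x

module _ {V : Set} {S : V → Set} (S? : Decidable S) (μ₁ μ₂ : V → V) where

  glue : V → V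
  glue z = if does (S? z) then μ₂ z else μ₁ z

  glue-inside : ∀ {z} → S z → glue z ≡ μ₂ z
  glue-inside {z} s rewrite dec-true (S? z) s = refl

  glue-outside : ∀ {z} → ¬ S z → glue z ≡ μ₁ z
  glue-outside {z} ¬s rewrite dec-false (S? z) ¬s = refl

glue-isPerfectMatching :
  ∀ {V : Set} {Adj : V → V → Set} {P₁ P₂ P S : V → Set} (S? : Decidable S) {μ₁ μ₂ : V → V} →
  IsPerfectMatching Adj P₁ μ₁ → IsPerfectMatching Adj P₂ μ₂ →
  (∀ {z} → S z → P₁ z → S (μ₁ z)) → (∀ {z} → S z → P₂ z → S (μ₂ z)) →
  (∀ {z} → S z → P z ⇔ P₂ z) → (∀ {z} → ¬ S z → P z ⇔ P₁ z) →
  IsPerfectMatching Adj P (glue S? μ₁ μ₂)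
glue-isPerfectMatching {S = S} S? {μ₁} {μ₂} matching₁ matching₂ closed₁ closed₂ inside outside z p
  with S? z
... | yes s =
  let p₂ = to (inside s) p
      (p₂′ , adjacent , involutive , fixfree) = matching₂ z p₂
      s′ = closed₂ s p₂
  in from (inside s′) p₂′ , adjacent , trans (glue-inside S? μ₁ μ₂ s′) involutive , fixfree
... | no ¬s =
  let p₁ = to (outside ¬s) p
      (p₁′ , adjacent , involutive , fixfree) = matching₁ z p₁
      ¬s′ = λ s′ → ¬s (subst S involutive (closed₁ s′ p₁′))
  in from (outside ¬s′) p₁′ , adjacent , trans (glue-outside S? μ₁ μ₂ ¬s′) involutive , fixfree

-- Walks alternating between two perfect matchings μ true, μ false of the subgraphs induced
-- on Present true, Present false.  A state (x , t) is at x about to follow μ t.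
module AlternatingWalk {m : ℕ} {Adj : Fin m → Fin m → Set}
         (Present : Bool → Fin m → Set) (present? : ∀ t x → Dec (Present t x))
         (μ : Bool → Fin m → Fin m) (μ-matching : ∀ t → IsPerfectMatching Adj (Present t) (μ t))
         where

  μ-present : ∀ {t x} → Present t x → Present t (μ t x)
  μ-present {t} {x} p = proj₁ (μ-matching t x p)

  μ-involutive : ∀ {t x} → Present t x → μ t (μ t x) ≡ x
  μ-involutive {t} {x} p = proj₁ (proj₂ (proj₂ (μ-matching t x p)))

  μ-fixfree : ∀ {t x} → Present t x → μ t x ≢ x
  μ-fixfree {t} {x} p = proj₂ (proj₂ (proj₂ (μ-matching t x p)))

  State : Set
  State = Fin m × Bool

  step : State → State
  step (x , t) = μ t x , not t

  opposite : State → State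
  opposite (x , t) = x , not t

  walk : State → ℕ → State
  walk s zero    = s
  walk s (suc l) = step (walk s l)

  Valid : State → Set
  Valid (x , t) = Present t x

  Endpoint : Bool → Fin m → Set
  Endpoint t x = Present t x × ¬ Present (not t) x

  ExitsAfter : State → ℕ → Set
  ExitsAfter s = FirstFailure (Valid ∘ walk s)

  step-injective : ∀ {p q} → Valid p → Valid q → step p ≡ step q → p ≡ q
  step-injective {x , t} {y , u} p q step≡ with not-injective (cong proj₂ step≡)
  ... | refl = cong (_, t) (begin
    x             ≡⟨ μ-involutive p ⟨
    μ t (μ t x)   ≡⟨ cong (μ t ∘ proj₁) step≡ ⟩
    μ t (μ t y)   ≡⟨ μ-involutive q ⟩
    y             ∎)
    where open ≡-Reasoning

  step-≢-endpoint : ∀ {t e p} → Endpoint t e → Valid p → step p ≢ (e , t)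
  step-≢-endpoint {p = x , u} (_ , absent) p step≡ =
    absent (subst₂ Present (trans (sym (not-involutive u)) (cong (not ∘ proj₂) step≡))
                           (cong proj₁ step≡) (μ-present p))

  walk-injective : ∀ {t e N} → Endpoint t e → (∀ l → l ≤ N → Valid (walk (e , t) l)) →
                   ∀ {a b} → a < b → b ≤ N → walk (e , t) a ≢ walk (e , t) b
  walk-injective ep valid {zero}  {suc b} _ b<N eq =
    step-≢-endpoint ep (valid b (<⇒≤ b<N)) (sym eq)
  walk-injective ep valid {suc a} {suc b} (s≤s a<b) b<N eq =
    walk-injective ep valid a<b (<⇒≤ b<N)
      (step-injective (valid a (<⇒≤ (<-trans a<b b<N))) (valid b (<⇒≤ b<N)) eq)

  Bool↣Fin2 : Bool ↣ Fin 2
  Bool↣Fin2 = ↔⇒↣ (↔-sym 2↔Bool)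

  encode : State → Fin (m * 2)
  encode (x , t) = combine x (Injection.to Bool↣Fin2 t)

  encode-injective : ∀ {p q} → encode p ≡ encode q → p ≡ q
  encode-injective {x , t} {y , u} eq with combine-injective x _ y _ eq
  ... | refl , t≡u = cong (x ,_) (Injection.injective Bool↣Fin2 t≡u)

  exit : ∀ {t e} → Endpoint t e → ∃ (ExitsAfter (e , t))
  exit {t} {e} ep with firstFailure-or-all (λ l → present? _ _) (proj₁ ep) (m * 2)
  ... | inj₁ failure = failure
  ... | inj₂ valid =
    let (i , j , i<j , encode≡) = pigeonhole (n<1+n (m * 2)) (encode ∘ walk (e , t) ∘ toℕ)
    in ⊥-elim (walk-injective ep valid i<j (toℕ≤pred[n] j) (encode-injective encode≡))

  exitVertex : ∀ {t e} → Endpoint t e → Fin m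
  exitVertex {t} {e} ep = proj₁ (walk (e , t) (suc (proj₁ (exit ep))))

  exitVertex-unique : ∀ {t e k} (ep : Endpoint t e) → ExitsAfter (e , t) k →
                      exitVertex ep ≡ proj₁ (walk (e , t) (suc k))
  exitVertex-unique {t} {e} ep exits =
    cong (λ k → proj₁ (walk (e , t) (suc k))) (firstFailure-unique (proj₂ (exit ep)) exits)

  module Path {t₀ e k} (ep : Endpoint t₀ e) (exits : ExitsAfter (e , t₀) k) where

    x : ℕ → Fin m
    x l = proj₁ (walk (e , t₀) l)

    ty : ℕ → Bool
    ty l = proj₂ (walk (e , t₀) l)

    valid : ∀ {l} → l ≤ k → Present (ty l) (x l)
    valid = proj₁ exits _

    present-next : ∀ {l} → l ≤ k → Present (ty l) (x (suc l))
    present-next = μ-present ∘ valid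

    back : ∀ {l} → l ≤ k → μ (ty l) (x (suc l)) ≡ x l
    back = μ-involutive ∘ valid

    interior-present : ∀ {l} → suc l ≤ k → ∀ t → Present t (x (suc l))
    interior-present {l} l<k = Bool-cover (ty l) (present-next (<⇒≤ l<k)) (valid l<k)

    last-endpoint : Endpoint (ty k) (x (suc k))
    last-endpoint = present-next ≤-refl , proj₂ exits

    OnPath : Fin m → Set
    OnPath z = ∃ λ l → l < 2 + k × x l ≡ z

    onPath? : Decidable OnPath
    onPath? z = anyUpTo? (λ l → x l ≟ z) (2 + k)

    first-onPath : OnPath e
    first-onPath = 0 , z<s , refl

    last-onPath : OnPath (x (suc k))
    last-onPath = suc k , n<1+n (suc k) , refl

    onPath-closed : ∀ {z} → OnPath z → ∀ t → Present t z → OnPath (μ t z)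
    onPath-closed (l , l<2+k , refl) =
      Bool-cover {P = λ t → Present t (x l) → OnPath (μ t (x l))} (ty l) (forward l<2+k) (backward l<2+k)
      where
      forward : ∀ {l} → l < 2 + k → Present (ty l) (x l) → OnPath (μ (ty l) (x l))
      forward {l} l<2+k p with m≤n⇒m<n∨m≡n (s≤s⁻¹ l<2+k)
      ... | inj₁ l<1+k = suc l , s≤s l<1+k , refl
      ... | inj₂ refl  = ⊥-elim (proj₂ exits p)
      backward : ∀ {l} → l < 2 + k → Present (not (ty l)) (x l) → OnPath (μ (not (ty l)) (x l))
      backward {zero}  _       p = ⊥-elim (proj₂ ep p)
      backward {suc l} l<2+k _ =
        l , <-trans (n<1+n l) l<2+k ,
        sym (trans (cong (λ t → μ t (x (suc l))) (not-involutive (ty l))) (back (s≤s⁻¹ (s≤s⁻¹ l<2+k))))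

    step-opposite : ∀ {a} → a ≤ k → step (opposite (walk (e , t₀) (suc a))) ≡ opposite (walk (e , t₀) a)
    step-opposite {a} a≤k =
      cong₂ _,_ (trans (cong (λ t → μ t (x (suc a))) (not-involutive (ty a))) (back a≤k))
                (not-involutive (not (ty a)))

    -- Folding the path onto itself would make a vertex its own partner (odd fold) or a
    -- type equal to its negation (even fold).
    no-fold : ∀ d {a b} → d + a ≡ b → b ≤ suc k → walk (e , t₀) a ≢ opposite (walk (e , t₀) b)
    no-fold zero          refl _   eq = not-¬ refl (cong proj₂ eq)
    no-fold (suc zero)    refl b≤  eq = μ-fixfree (valid (s≤s⁻¹ b≤)) (sym (cong proj₁ eq))
    no-fold (suc (suc d)) {a} refl b≤ eq =
      no-fold d (+-suc d a) (<⇒≤ b≤) (begin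
        walk (e , t₀) (suc a)                          ≡⟨ cong step eq ⟩
        step (opposite (walk (e , t₀) (2 + d + a)))     ≡⟨ step-opposite (s≤s⁻¹ b≤) ⟩
        opposite (walk (e , t₀) (suc d + a))            ∎)
      where open ≡-Reasoning

    last≢first : x (suc k) ≢ e
    last≢first last≡e = no-fold (suc k) (+-identityʳ (suc k)) ≤-refl
      (cong₂ _,_ (sym last≡e) (sym (trans (not-involutive (ty k)) ty-k≡t₀)))
      where
      ty-k≡t₀ : ty k ≡ t₀
      ty-k≡t₀ with ty k Bool.≟ t₀
      ... | yes eq = eq
      ... | no neq = ⊥-elim (proj₂ ep (subst₂ Present (¬-not neq) last≡e (proj₁ last-endpoint)))

    reverse : State
    reverse = opposite (walk (e , t₀) (suc k))

    walk-reverse : ∀ j a → j + a ≡ suc k → walk reverse j ≡ opposite (walk (e , t₀) a)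
    walk-reverse zero    a refl = refl
    walk-reverse (suc j) a j+a≡ = begin
      step (walk reverse j)                         ≡⟨ cong step (walk-reverse j (suc a) (trans (+-suc j a) j+a≡)) ⟩
      step (opposite (walk (e , t₀) (suc a)))        ≡⟨ step-opposite a≤k ⟩
      opposite (walk (e , t₀) a)                     ∎
      where
      open ≡-Reasoning
      a≤k : a ≤ k
      a≤k = ≤-trans (m≤n+m a j) (≤-reflexive (suc-injective j+a≡))

    reverse-exit : proj₁ (walk reverse (suc k)) ≡ e
    reverse-exit = cong proj₁ (walk-reverse (suc k) 0 (+-identityʳ (suc k)))

    reverse-exits : ExitsAfter reverse k
    reverse-exits = valid-reverse , λ v → proj₂ ep (subst Valid (walk-reverse (suc k) 0 (+-identityʳ (suc k))) v)
      where
      valid-reverse : ∀ j → j ≤ k → Valid (walk reverse j)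
      valid-reverse j j≤k =
        subst Valid (sym (walk-reverse j (suc (k ∸ j)) (trans (+-suc j (k ∸ j)) (cong suc (m+[n∸m]≡n j≤k)))))
          (subst (λ t → Present t (x (suc (k ∸ j)))) (sym (not-involutive (ty (k ∸ j))))
            (present-next (m∸n≤m k j)))

module Realization (G : Graph) {n} (vs : Fin n → Fin (Graph.m G)) (vs-injective : Injective _≡_ _≡_ vs)
                   {f g : Tuple n} (f-matched : MatchRel G vs f) (g-matched : MatchRel G vs g) where

  tuple : Bool → Tuple n
  tuple true  = f
  tuple false = g

  Present : Bool → Fin (Graph.m G) → Set
  Present t z = ¬ Deleted G vs (tuple t) z

  deleted? : ∀ α z → Dec (Deleted G vs α z)
  deleted? α z = any? (λ c → (vs c ≟ z) ×-dec (α c Bool.≟ true))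

  μ : Bool → Fin (Graph.m G) → Fin (Graph.m G)
  μ true  = proj₁ f-matched
  μ false = proj₁ g-matched

  μ-matching : ∀ t → IsPerfectMatching (Graph.Adj G) (Present t) (μ t)
  μ-matching true  = proj₂ f-matched
  μ-matching false = proj₂ g-matched

  open AlternatingWalk {Adj = Graph.Adj G} Present (λ t z → ¬? (deleted? (tuple t) z)) μ μ-matching

  deleted-vs : ∀ {α c} → Deleted G vs α (vs c) → α c ≡ true
  deleted-vs (c′ , vs-c′≡vs-c , αc′) with vs-injective vs-c′≡vs-c
  ... | refl = αc′

  present-vs : ∀ {t c} → Present t (vs c) → tuple t c ≡ false
  present-vs {c = c} p = ¬-not λ tc → p (c , refl , tc)

  absent-vs : ∀ {t c} → ¬ Present t (vs c) → tuple t c ≡ true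
  absent-vs {t} {c} np = deleted-vs (decidable-stable (deleted? (tuple t) (vs c)) np)

  present-cong : ∀ {α β z} → (∀ c → vs c ≡ z → α c ≡ β c) →
                 (¬ Deleted G vs α z) ⇔ (¬ Deleted G vs β z)
  present-cong agree = mk⇔ (λ p (c , vs-c≡z , βc) → p (c , vs-c≡z , trans (agree c vs-c≡z) βc))
                           (λ p (c , vs-c≡z , αc) → p (c , vs-c≡z , trans (sym (agree c vs-c≡z)) αc))

  endpoint-vs : ∀ {c} → f c ≢ g c → Endpoint (not (f c)) (vs c)
  endpoint-vs {c} f≢g with f c in fc | g c in gc
  ... | false | true  = (λ d → not-¬ fc (deleted-vs d)) , (λ p → p (c , refl , gc))
  ... | true  | false = (λ d → not-¬ gc (deleted-vs d)) , (λ p → p (c , refl , fc))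
  ... | false | false = ⊥-elim (f≢g refl)
  ... | true  | true  = ⊥-elim (f≢g refl)

  endpoint-vs⁻ : ∀ {t c} → Endpoint t (vs c) → f c ≢ g c × t ≡ not (f c)
  endpoint-vs⁻ {true}  (p , np) = (λ f≡g → not-¬ (present-vs p) (trans f≡g (absent-vs np))) ,
                                  cong not (sym (present-vs p))
  endpoint-vs⁻ {false} (p , np) = (λ f≡g → not-¬ (present-vs p) (trans (sym f≡g) (absent-vs np))) ,
                                  sym (cong not (absent-vs np))

  not-tuple : ∀ {c} → f c ≢ g c → ∀ t → not (tuple t c) ≡ tuple (not t) c
  not-tuple f≢g true  = sym (¬-not (f≢g ∘ sym))
  not-tuple f≢g false = sym (¬-not f≢g)

  partner : Fin n → Fin n
  partner c with f c Bool.≟ g c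
  ... | yes _   = c
  ... | no f≢g = preimage vs c (exitVertex (endpoint-vs f≢g))

  partner-exit : ∀ {c s k} → f c ≢ g c → s ≡ (vs c , not (f c)) → ExitsAfter s k →
                 partner c ≡ preimage vs c (proj₁ (walk s (suc k)))
  partner-exit {c} f≢g refl exits with f c Bool.≟ g c
  ... | yes f≡g  = ⊥-elim (f≢g f≡g)
  ... | no f≢g′ = cong (preimage vs c) (exitVertex-unique (endpoint-vs f≢g′) exits)

  module Pair {c} (c-differs : f c ≢ g c) where

    ep : Endpoint (not (f c)) (vs c)
    ep = endpoint-vs c-differs

    k : ℕ
    k = proj₁ (exit ep)

    open Path ep (proj₂ (exit ep))

    other-end : Deleted G vs (tuple (not (ty k))) (x (suc k))
    other-end = decidable-stable (deleted? _ _) (proj₂ last-endpoint)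

    j : Fin n
    j = proj₁ other-end

    vs-j : vs j ≡ x (suc k)
    vs-j = proj₁ (proj₂ other-end)

    j-differs : f j ≢ g j
    j-differs = proj₁ (endpoint-vs⁻ (subst (Endpoint (ty k)) (sym vs-j) last-endpoint))

    j-type : ty k ≡ not (f j)
    j-type = proj₂ (endpoint-vs⁻ (subst (Endpoint (ty k)) (sym vs-j) last-endpoint))

    partner≡j : partner c ≡ j
    partner≡j = begin
      partner c                       ≡⟨ partner-exit c-differs refl (proj₂ (exit ep)) ⟩
      preimage vs c (x (suc k))       ≡⟨ cong (preimage vs c) vs-j ⟨
      preimage vs c (vs j)            ≡⟨ preimage-image vs-injective c j ⟩
      j                               ∎
      where open ≡-Reasoning

    partner-j≡c : partner j ≡ c
    partner-j≡c = begin
      partner j                                  ≡⟨ partner-exit j-differs reverse≡ reverse-exits ⟩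
      preimage vs j (proj₁ (walk reverse (suc k))) ≡⟨ cong (preimage vs j) reverse-exit ⟩
      preimage vs j (vs c)                       ≡⟨ preimage-image vs-injective j c ⟩
      c                                          ∎
      where
      open ≡-Reasoning
      reverse≡ : reverse ≡ (vs j , not (f j))
      reverse≡ = cong₂ _,_ (sym vs-j) (trans (not-involutive (ty k)) j-type)

    interior-vs-present : ∀ {c′} → OnPath (vs c′) → c′ ≢ c → c′ ≢ j → ∀ t → Present t (vs c′)
    interior-vs-present (zero , _ , e≡vs-c′) c′≢c _ _ = ⊥-elim (c′≢c (vs-injective (sym e≡vs-c′)))
    interior-vs-present (suc l , l<2+k , x≡vs-c′) c′≢c c′≢j t with m≤n⇒m<n∨m≡n (s≤s⁻¹ l<2+k)
    ... | inj₁ l<k = subst (Present t) x≡vs-c′ (interior-present (s≤s⁻¹ l<k) t)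
    ... | inj₂ refl = ⊥-elim (c′≢j (vs-injective (trans (sym x≡vs-c′) (sym vs-j))))

    flip-onPath : ∀ t c′ → OnPath (vs c′) → flip2 (tuple t) c j c′ ≡ tuple (not t) c′
    flip-onPath t c′ on = by-cases (c′ ≟ c) (c′ ≟ j)
      where
      by-cases : Dec (c′ ≡ c) → Dec (c′ ≡ j) → flip2 (tuple t) c j c′ ≡ tuple (not t) c′
      by-cases (yes refl) _          = trans (flip2-first (tuple t) c j) (not-tuple c-differs t)
      by-cases (no _)     (yes refl) = trans (flip2-second (tuple t) c j) (not-tuple j-differs t)
      by-cases (no c′≢c)  (no c′≢j)  =
        trans (flip2-other (tuple t) c′≢c c′≢j)
              (trans (present-vs (interior-vs-present on c′≢c c′≢j t)) (sym (present-vs (interior-vs-present on c′≢c c′≢j (not t)))))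

    flip-offPath : ∀ t c′ → ¬ OnPath (vs c′) → flip2 (tuple t) c j c′ ≡ tuple t c′
    flip-offPath t c′ off =
      flip2-other (tuple t) (λ { refl → off first-onPath }) (λ { refl → off (subst OnPath (sym vs-j) last-onPath) })

    flipped-matched : ∀ t → MatchRel G vs (flip2 (tuple t) c j)
    flipped-matched t =
      glue onPath? (μ t) (μ (not t)) ,
      glue-isPerfectMatching {Adj = Graph.Adj G} onPath? (μ-matching t) (μ-matching (not t))
        (λ on → onPath-closed on t) (λ on → onPath-closed on (not t))
        (λ on → present-cong λ c′ vs-c′≡z → flip-onPath t c′ (subst OnPath (sym vs-c′≡z) on))
        (λ off → present-cong λ c′ vs-c′≡z → flip-offPath t c′ (off ∘ subst OnPath vs-c′≡z))

    paired : f (partner c) ≢ g (partner c) × partner c ≢ c × partner (partner c) ≡ c ×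
             MatchRel G vs (flip2 f c (partner c)) × MatchRel G vs (flip2 g c (partner c))
    paired rewrite partner≡j =
      j-differs , (λ j≡c → last≢first (trans (sym vs-j) (cong vs j≡c))) , partner-j≡c ,
      flipped-matched true , flipped-matched false

  pairPartition : PairPartition (MatchRel G vs) f g
  pairPartition = partner , λ c c-differs → Pair.paired c-differs

mainTheorem11 : ∀ {n} (M : Rel01 n) → MatchingRealizable M → IsDeltaMatroid M → IsEven M →
                ∀ f g → M f → M g → PairPartition M f g
mainTheorem11 M (G , vs , vs-injective , realizes) _ _ f g Mf Mg =
  PairPartition-mono (λ T → from (realizes T))
    (Realization.pairPartition G vs vs-injective (to (realizes f) Mf) (to (realizes g) Mg))
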